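{- Consider the following axioms, where $A\Leftrightarrow B$ abbreviates the two sequents $A\Rightarrow B$ and $B\Rightarrow A$: - $(D_a)$: $A\wedge(B\vee C)\Leftrightarrow(A\wedge B)\vee(A\wedge C)$; - $(N_a)$: $\nabla(A\wedge B)\Leftrightarrow\nabla A\wedge\nabla B$ and $\nabla\top\Leftrightarrow\top$; - $(R_a)$: $A\Rightarrow\nabla A$; - $(L_a)$: $\nabla A\Rightarrow A$; - $(Fa_a)$: $A\Leftrightarrow\nabla(\top\to A)$; - $(Fu_a)$: $A\Leftrightarrow\top\to\nabla A$. For every $C\subseteq\{D,N,R,L,Fa,Fu\}$, $\mathbf{STL}(C)=\mathbf{STL}(C_a)$ (i.e., they prove the same sequents from the same premises), where $C_a=\{\mathcal{X}_a\mid\mathcal{X}\in C\}$ and $\mathbf{STL}(C_a)$ is $\mathbf{STL}$ extended by all instances of the axioms in $C_a$.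
   Context: Language $\mathcal{L}=\{\wedge,\vee,\to,\top,\bot,\nabla\}$. A sequent is $\Gamma\Rightarrow\Delta$ with $\Gamma,\Delta$ finite multisets of formulas and $|\Delta|\le1$; $\nabla\Gamma=\{\nabla\gamma\mid\gamma\in\Gamma\}$. $\mathbf{STL}$ has the following rules (premises / conclusion): - Axioms: $A\Rightarrow A$; $\bot\Rightarrow$; $\Rightarrow\top$. - Weakening: $\Gamma\Rightarrow\Delta$ / $\Gamma,A\Rightarrow\Delta$; $\Gamma\Rightarrow$ / $\Gamma\Rightarrow A$. - Contraction: $\Gamma,A,A\Rightarrow\Delta$ / $\Gamma,A\Rightarrow\Delta$. - Cut: $\Gamma\Rightarrow A$ and $\Pi,A\Rightarrow\Delta$ / $\Pi,\Gamma\Rightarrow\Delta$. - Conjunction: $\Gamma,A\Rightarrow\Delta$ / $\Gamma,A\wedge B\Rightarrow\Delta$; $\Gamma,B\Rightarrow\Delta$ / $\Gamma,A\wedge B\Rightarrow\Delta$; $\Gamma\Rightarrow A$ and $\Gamma\Rightarrow B$ / $\Gamma\Rightarrow A\wedge B$. - Disjunction: $A\Rightarrow\Delta$ and $B\Rightarrow\Delta$ / $A\vee B\Rightarrow\Delta$; $\Gamma\Rightarrow A$ / $\Gamma\Rightarrow A\vee B$; $\Gamma\Rightarrow B$ / $\Gamma\Rightarrow A\vee B$. - Modality: $A\Rightarrow B$ / $\nabla A\Rightarrow\nabla B$. - Left implication: $\Gamma\Rightarrow A$ and $\Gamma,B\Rightarrow\Delta$ / $\Gamma,\nabla(A\to B)\Rightarrow\Delta$.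 - Right implication: $\nabla\Gamma,A\Rightarrow B$ / $\Gamma\Rightarrow A\to B$. Additional rules: - (R): $\Gamma\Rightarrow A$ / $\Gamma\Rightarrow\nabla A$. - (L): $\Gamma,A\Rightarrow\Delta$ / $\Gamma,\nabla A\Rightarrow\Delta$. - (D): $\Gamma,A\Rightarrow\Delta$ and $\Gamma,B\Rightarrow\Delta$ / $\Gamma,A\vee B\Rightarrow\Delta$. - (N): $\Gamma\Rightarrow\Delta$ / $\nabla\Gamma\Rightarrow\nabla\Delta$. - (Fa): $\Gamma,A\Rightarrow B$ / $\Gamma\Rightarrow\nabla(A\to B)$. - (Fu): $\nabla\Gamma\Rightarrow A$ and $\nabla\Gamma,B\Rightarrow\nabla\Delta$ / $\Gamma,A\to B\Rightarrow\Delta$. $\mathbf{STL}(C)$ is $\mathbf{STL}$ plus the rules in $C$. $\mathcal{S}\vdash_G S$ means there is a finite sequence of sequents ending in $S$, each a member of $\mathcal{S}$ or obtained from earlier ones by a rule instance of $G$. -}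

module Defs where

open import Data.Nat using (ℕ)
open import Data.List using (List; []; _∷_; _++_; [_]; map)
open import Data.Maybe using (Maybe; just; nothing) renaming (map to mmap)
open import Data.Product using (Σ; _×_; _,_)
open import Data.Sum using (_⊎_)
open import Data.List.Relation.Unary.All using (All)
open import Data.List.Relation.Binary.Permutation.Propositional using (_↭_)
open import Relation.Binary.PropositionalEquality using (_≡_)

infixr 6 _∧'_
infixr 5 _∨'_
infixr 4 _⟶_
data Fml : Set where
  var  : ℕ → Fml
  ⊤'   : Fml
  ⊥'   : Fml
  _∧'_ : Fml → Fml → Fml
  _∨'_ : Fml → Fml → Fml
  _⟶_  : Fml → Fml → Fml
  ∇    : Fml → Fml

-- Sequent Γ ⇒ Δ with |Δ| ≤ 1. The antecedent is a multiset, represented by a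
-- list taken up to permutation (see the Exchange rule below).
infix 3 _⇒_
record Sequent : Set where
  constructor _⇒_
  field
    ant : List Fml
    suc : Maybe Fml

∇s : List Fml → List Fml
∇s = map ∇

RuleSet : Set₁
RuleSet = List Sequent → Sequent → Set

data Exchange : RuleSet where
  exch : ∀ {Γ Γ' Δ} → Γ ↭ Γ' → Exchange [ Γ ⇒ Δ ] (Γ' ⇒ Δ)

data STLRule : RuleSet where
  ax     : ∀ A → STLRule [] ([ A ] ⇒ just A)
  ax⊥    : STLRule [] ([ ⊥' ] ⇒ nothing)
  ax⊤    : STLRule [] ([] ⇒ just ⊤')
  wkL    : ∀ Γ Δ A → STLRule [ Γ ⇒ Δ ] (A ∷ Γ ⇒ Δ)
  wkR    : ∀ Γ A → STLRule [ Γ ⇒ nothing ] (Γ ⇒ just A)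
  ctr    : ∀ Γ Δ A → STLRule [ A ∷ A ∷ Γ ⇒ Δ ] (A ∷ Γ ⇒ Δ)
  cut    : ∀ Γ Π Δ A → STLRule ((Γ ⇒ just A) ∷ (A ∷ Π ⇒ Δ) ∷ []) (Π ++ Γ ⇒ Δ)
  ∧L₁    : ∀ Γ Δ A B → STLRule [ A ∷ Γ ⇒ Δ ] ((A ∧' B) ∷ Γ ⇒ Δ)
  ∧L₂    : ∀ Γ Δ A B → STLRule [ B ∷ Γ ⇒ Δ ] ((A ∧' B) ∷ Γ ⇒ Δ)
  ∧R     : ∀ Γ A B → STLRule ((Γ ⇒ just A) ∷ (Γ ⇒ just B) ∷ []) (Γ ⇒ just (A ∧' B))
  ∨L     : ∀ Δ A B → STLRule (([ A ] ⇒ Δ) ∷ ([ B ] ⇒ Δ) ∷ []) ([ A ∨' B ] ⇒ Δ)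
  ∨R₁    : ∀ Γ A B → STLRule [ Γ ⇒ just A ] (Γ ⇒ just (A ∨' B))
  ∨R₂    : ∀ Γ A B → STLRule [ Γ ⇒ just B ] (Γ ⇒ just (A ∨' B))
  mod    : ∀ A B → STLRule [ [ A ] ⇒ just B ] ([ ∇ A ] ⇒ just (∇ B))
  ⟶L     : ∀ Γ Δ A B → STLRule ((Γ ⇒ just A) ∷ (B ∷ Γ ⇒ Δ) ∷ []) (∇ (A ⟶ B) ∷ Γ ⇒ Δ)
  ⟶R     : ∀ Γ A B → STLRule [ A ∷ ∇s Γ ⇒ just B ] (Γ ⇒ just (A ⟶ B))

data Ext : Set where
  D N R L Fa Fu : Ext

data ExtRule : Ext → RuleSet where
  rR  : ∀ Γ A → ExtRule R [ Γ ⇒ just A ] (Γ ⇒ just (∇ A))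
  rL  : ∀ Γ Δ A → ExtRule L [ A ∷ Γ ⇒ Δ ] (∇ A ∷ Γ ⇒ Δ)
  rD  : ∀ Γ Δ A B → ExtRule D ((A ∷ Γ ⇒ Δ) ∷ (B ∷ Γ ⇒ Δ) ∷ []) ((A ∨' B) ∷ Γ ⇒ Δ)
  rN  : ∀ Γ Δ → ExtRule N [ Γ ⇒ Δ ] (∇s Γ ⇒ mmap ∇ Δ)
  rFa : ∀ Γ A B → ExtRule Fa [ A ∷ Γ ⇒ just B ] (Γ ⇒ just (∇ (A ⟶ B)))
  rFu : ∀ Γ Δ A B → ExtRule Fu ((∇s Γ ⇒ just A) ∷ (B ∷ ∇s Γ ⇒ mmap ∇ Δ) ∷ [])
                                ((A ⟶ B) ∷ Γ ⇒ Δ)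

data ExtAx : Ext → Sequent → Set where
  Da₁  : ∀ A B C → ExtAx D ([ A ∧' (B ∨' C) ] ⇒ just ((A ∧' B) ∨' (A ∧' C)))
  Da₂  : ∀ A B C → ExtAx D ([ (A ∧' B) ∨' (A ∧' C) ] ⇒ just (A ∧' (B ∨' C)))
  Na₁  : ∀ A B → ExtAx N ([ ∇ (A ∧' B) ] ⇒ just (∇ A ∧' ∇ B))
  Na₂  : ∀ A B → ExtAx N ([ ∇ A ∧' ∇ B ] ⇒ just (∇ (A ∧' B)))
  Na₃  : ExtAx N ([ ∇ ⊤' ] ⇒ just ⊤')
  Na₄  : ExtAx N ([ ⊤' ] ⇒ just (∇ ⊤'))
  Ra   : ∀ A → ExtAx R ([ A ] ⇒ just (∇ A))
  La   : ∀ A → ExtAx L ([ ∇ A ] ⇒ just A)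
  Faa₁ : ∀ A → ExtAx Fa ([ A ] ⇒ just (∇ (⊤' ⟶ A)))
  Faa₂ : ∀ A → ExtAx Fa ([ ∇ (⊤' ⟶ A) ] ⇒ just A)
  Fua₁ : ∀ A → ExtAx Fu ([ A ] ⇒ just (⊤' ⟶ ∇ A))
  Fua₂ : ∀ A → ExtAx Fu ([ ⊤' ⟶ ∇ A ] ⇒ just A)

STL[_] : (Ext → Set) → RuleSet
STL[ C ] ps c = STLRule ps c ⊎ Exchange ps c ⊎ Σ Ext (λ x → C x × ExtRule x ps c)

STLa[_] : (Ext → Set) → RuleSet
STLa[ C ] ps c = STLRule ps c ⊎ Exchange ps c ⊎ (ps ≡ [] × Σ Ext (λ x → C x × ExtAx x c))

-- Derivability from a set of premises 𝒮 (a predicate on sequents) in a rule set G.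
-- (Equivalent to the existence of a finite derivation sequence.)
data _⊢[_]_ (𝒮 : Sequent → Set) (G : RuleSet) : Sequent → Set where
  premise : ∀ {s} → 𝒮 s → 𝒮 ⊢[ G ] s
  by      : ∀ {ps c} → G ps c → All (𝒮 ⊢[ G ]_) ps → 𝒮 ⊢[ G ] c

{-# OPTIONS --safe #-}
-- A derivation in one system is translated rule instance by rule instance
-- into the other, so it suffices that each rule X is a derived rule of
-- STL(X_a) and each axiom X_a is derivable in STL(X).  The axioms need at
-- most one application of their rule.  For the rules, the context Γ is packed
-- into the conjunction ⋀Γ: D then follows from D_a applied to ⋀Γ ∧ (A ∨ B),
-- N from ∇Γ ⇒ ∇⋀Γ (by N_a) and monotonicity of ∇, Fa by turning ⋀Γ into
-- ∇(⊤ → ⋀Γ) with Fa_a, and Fu by deriving ⊤ → ∇Δ with STL's implication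
-- rules and stripping it with Fu_a.
module Submission where

open import Defs
open import Data.Product using (_×_; _,_; Σ)
open import Data.Sum using (_⊎_; inj₁; inj₂)
open import Data.List using (List; []; _∷_; _++_; [_]; foldr)
open import Data.List.Properties using (++-identityʳ)
open import Data.Maybe using (just; nothing) renaming (map to mmap)
open import Data.List.Relation.Unary.All using (All; []; _∷_)
open import Data.List.Relation.Binary.Permutation.Propositional
  using (_↭_; ↭-reflexive; swap; ↭-refl)
open import Data.List.Relation.Binary.Permutation.Propositional.Properties
  using (++-comm; shift)
open import Relation.Binary.PropositionalEquality using (_≡_; refl)

_DerivableIn_ : RuleSet → RuleSet → Set₁
G DerivableIn H = ∀ {𝒮 ps c} → G ps c → All (𝒮 ⊢[ H ]_) ps → 𝒮 ⊢[ H ] c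

module _ {G H : RuleSet} (G⊆H : G DerivableIn H) where
  mutual
    simulate : ∀ {𝒮 s} → 𝒮 ⊢[ G ] s → 𝒮 ⊢[ H ] s
    simulate (premise p) = premise p
    simulate (by r ds) = G⊆H r (simulate-all ds)

    simulate-all : ∀ {𝒮 ps} → All (𝒮 ⊢[ G ]_) ps → All (𝒮 ⊢[ H ]_) ps
    simulate-all [] = []
    simulate-all (d ∷ ds) = simulate d ∷ simulate-all ds

STL+ : RuleSet → RuleSet
STL+ X ps c = STLRule ps c ⊎ Exchange ps c ⊎ X ps c

STL+-derivableIn : ∀ {X Y} → X DerivableIn STL+ Y → STL+ X DerivableIn STL+ Y
STL+-derivableIn _ (inj₁ r) = by (inj₁ r)
STL+-derivableIn _ (inj₂ (inj₁ e)) = by (inj₂ (inj₁ e))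
STL+-derivableIn X⊆Y (inj₂ (inj₂ x)) = X⊆Y x

ExtRules : (Ext → Set) → RuleSet
ExtRules C ps c = Σ Ext λ x → C x × ExtRule x ps c

ExtAxioms : (Ext → Set) → RuleSet
ExtAxioms C ps c = ps ≡ [] × Σ Ext λ x → C x × ExtAx x c

⋀ : List Fml → Fml
⋀ = foldr _∧'_ ⊤'

module STL-Derivations (X : RuleSet) (𝒮 : Sequent → Set) where
  infix 2 ⊢_
  ⊢_ : Sequent → Set
  ⊢ s = 𝒮 ⊢[ STL+ X ] s

  stl₀ : ∀ {c} → STLRule [] c → ⊢ c
  stl₀ r = by (inj₁ r) []

  stl₁ : ∀ {p c} → STLRule [ p ] c → ⊢ p → ⊢ c
  stl₁ r d = by (inj₁ r) (d ∷ [])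

  stl₂ : ∀ {p q c} → STLRule (p ∷ q ∷ []) c → ⊢ p → ⊢ q → ⊢ c
  stl₂ r d e = by (inj₁ r) (d ∷ e ∷ [])

  identity : ∀ A → ⊢ [ A ] ⇒ just A
  identity A = stl₀ (ax A)

  ⊥-left : ⊢ [ ⊥' ] ⇒ nothing
  ⊥-left = stl₀ ax⊥

  ⊤-right : ⊢ [] ⇒ just ⊤'
  ⊤-right = stl₀ ax⊤

  exchange : ∀ {Γ Γ' Δ} → Γ ↭ Γ' → ⊢ Γ ⇒ Δ → ⊢ Γ' ⇒ Δ
  exchange p d = by (inj₂ (inj₁ (exch p))) (d ∷ [])

  swap-head : ∀ {A B Γ Δ} → ⊢ A ∷ B ∷ Γ ⇒ Δ → ⊢ B ∷ A ∷ Γ ⇒ Δ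
  swap-head = exchange (swap _ _ ↭-refl)

  weaken-left : ∀ {Γ Δ} A → ⊢ Γ ⇒ Δ → ⊢ A ∷ Γ ⇒ Δ
  weaken-left A = stl₁ (wkL _ _ A)

  weaken-right : ∀ {Γ} A → ⊢ Γ ⇒ nothing → ⊢ Γ ⇒ just A
  weaken-right A = stl₁ (wkR _ A)

  weaken-prefix : ∀ {Γ Δ} Π → ⊢ Γ ⇒ Δ → ⊢ Π ++ Γ ⇒ Δ
  weaken-prefix [] d = d
  weaken-prefix (A ∷ Π) d = weaken-left A (weaken-prefix Π d)

  weaken-suffix : ∀ {Γ Δ} Π → ⊢ Γ ⇒ Δ → ⊢ Γ ++ Π ⇒ Δ
  weaken-suffix {Γ} Π d = exchange (++-comm Π Γ) (weaken-prefix Π d)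

  infixl 4 _⨾_
  _⨾_ : ∀ {Γ A Δ} → ⊢ Γ ⇒ just A → ⊢ [ A ] ⇒ Δ → ⊢ Γ ⇒ Δ
  d ⨾ e = stl₂ (cut _ [] _ _) d e

  cut-head : ∀ {A B Π Δ} → ⊢ [ B ] ⇒ just A → ⊢ A ∷ Π ⇒ Δ → ⊢ B ∷ Π ⇒ Δ
  cut-head {B = B} {Π} d e = exchange (++-comm Π [ B ]) (stl₂ (cut _ Π _ _) d e)

  ∧-left : ∀ {A B Π Δ} → ⊢ A ∷ B ∷ Π ⇒ Δ → ⊢ (A ∧' B) ∷ Π ⇒ Δ
  ∧-left {A} {B} d =
    stl₁ (ctr _ _ _) (stl₁ (∧L₁ _ _ A B) (swap-head (stl₁ (∧L₂ _ _ A B) (swap-head d))))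

  ∧-right : ∀ {Γ A B} → ⊢ Γ ⇒ just A → ⊢ Γ ⇒ just B → ⊢ Γ ⇒ just (A ∧' B)
  ∧-right = stl₂ (∧R _ _ _)

  ∧-elimˡ : ∀ A B → ⊢ [ A ∧' B ] ⇒ just A
  ∧-elimˡ A B = stl₁ (∧L₁ [] _ A B) (identity A)

  ∧-elimʳ : ∀ A B → ⊢ [ A ∧' B ] ⇒ just B
  ∧-elimʳ A B = stl₁ (∧L₂ [] _ A B) (identity B)

  ∧-pair : ∀ A B → ⊢ A ∷ B ∷ [] ⇒ just (A ∧' B)
  ∧-pair A B = ∧-right (weaken-suffix [ B ] (identity A)) (weaken-left A (identity B))

  ∇-mono : ∀ {A B} → ⊢ [ A ] ⇒ just B → ⊢ [ ∇ A ] ⇒ just (∇ B)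
  ∇-mono = stl₁ (mod _ _)

  ⊤⟶-intro : ∀ {Γ B} → ⊢ ∇s Γ ⇒ just B → ⊢ Γ ⇒ just (⊤' ⟶ B)
  ⊤⟶-intro d = stl₁ (⟶R _ _ _) (weaken-left ⊤' d)

  ∇⊤⟶-elim : ∀ {Γ B Δ} → ⊢ B ∷ Γ ⇒ Δ → ⊢ ∇ (⊤' ⟶ B) ∷ Γ ⇒ Δ
  ∇⊤⟶-elim {Γ} d = stl₂ (⟶L _ _ _ _) (weaken-suffix Γ ⊤-right) d

  ∇⊥-left : ⊢ [ ∇ ⊥' ] ⇒ nothing
  ∇⊥-left = ∇-mono (weaken-right (⊤' ⟶ ⊥') ⊥-left) ⨾ ∇⊤⟶-elim ⊥-left

  ⋀-right : ∀ Γ → ⊢ Γ ⇒ just (⋀ Γ)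
  ⋀-right [] = ⊤-right
  ⋀-right (A ∷ Γ) =
    ∧-right (weaken-suffix Γ (identity A)) (weaken-left A (⋀-right Γ))

  ⋀-left : ∀ {Δ} Π Γ → ⊢ Π ++ Γ ⇒ Δ → ⊢ ⋀ Γ ∷ Π ⇒ Δ
  ⋀-left Π [] d = weaken-left ⊤' (exchange (↭-reflexive (++-identityʳ Π)) d)
  ⋀-left Π (A ∷ Γ) d =
    ∧-left (swap-head (⋀-left (A ∷ Π) Γ (exchange (shift A Π Γ) d)))

module RulesFromAxioms (C : Ext → Set) (𝒮 : Sequent → Set) where
  open STL-Derivations (ExtAxioms C) 𝒮

  axiom : ∀ {x c} → C x → ExtAx x c → ⊢ c
  axiom cx a = by (inj₂ (inj₂ (refl , _ , cx , a))) []

  ∇-⋀ : C N → ∀ Γ → ⊢ ∇s Γ ⇒ just (∇ (⋀ Γ))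
  ∇-⋀ cN [] = ⊤-right ⨾ axiom cN Na₄
  ∇-⋀ cN (A ∷ Γ) =
    ∧-right (weaken-suffix (∇s Γ) (identity (∇ A))) (weaken-left (∇ A) (∇-⋀ cN Γ))
      ⨾ axiom cN (Na₂ A (⋀ Γ))

  rule-R : ∀ {Γ A} → C R → ⊢ Γ ⇒ just A → ⊢ Γ ⇒ just (∇ A)
  rule-R cR d = d ⨾ axiom cR (Ra _)

  rule-L : ∀ {Γ Δ A} → C L → ⊢ A ∷ Γ ⇒ Δ → ⊢ ∇ A ∷ Γ ⇒ Δ
  rule-L cL d = cut-head (axiom cL (La _)) d

  rule-D : ∀ {Γ Δ A B} → C D → ⊢ A ∷ Γ ⇒ Δ → ⊢ B ∷ Γ ⇒ Δ → ⊢ (A ∨' B) ∷ Γ ⇒ Δ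
  rule-D {Γ} {A = A} {B} cD d e =
    ∧-right (weaken-left (A ∨' B) (⋀-right Γ)) (weaken-suffix Γ (identity (A ∨' B)))
      ⨾ axiom cD (Da₁ (⋀ Γ) A B)
      ⨾ stl₂ (∨L _ _ _) (∧-left (⋀-left [ A ] Γ d)) (∧-left (⋀-left [ B ] Γ e))

  rule-N : ∀ {Γ Δ} → C N → ⊢ Γ ⇒ Δ → ⊢ ∇s Γ ⇒ mmap ∇ Δ
  rule-N {Γ} {just _} cN d = ∇-⋀ cN Γ ⨾ ∇-mono (⋀-left [] Γ d)
  rule-N {Γ} {nothing} cN d =
    rule-N {Γ} {just ⊥'} cN (weaken-right ⊥' d) ⨾ ∇⊥-left

  rule-Fa : ∀ {Γ A B} → C Fa → ⊢ A ∷ Γ ⇒ just B → ⊢ Γ ⇒ just (∇ (A ⟶ B))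
  rule-Fa {Γ} {A} cFa d =
    ⋀-right Γ
      ⨾ axiom cFa (Faa₁ (⋀ Γ))
      ⨾ ∇-mono (stl₁ (⟶R _ _ _) (swap-head (∇⊤⟶-elim (⋀-left [ A ] Γ d))))

  rule-Fu : ∀ {Γ Δ A B} → C Fu → ⊢ ∇s Γ ⇒ just A → ⊢ B ∷ ∇s Γ ⇒ mmap ∇ Δ →
            ⊢ (A ⟶ B) ∷ Γ ⇒ Δ
  rule-Fu {Δ = just E} cFu d e =
    ⊤⟶-intro (stl₂ (⟶L _ _ _ _) d e) ⨾ axiom cFu (Fua₂ E)
  rule-Fu {Δ = nothing} cFu d e =
    rule-Fu {Δ = just ⊥'} cFu d (weaken-right (∇ ⊥') e) ⨾ ⊥-left

  rule : ∀ {x ps c} → C x → ExtRule x ps c → All ⊢_ ps → ⊢ c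
  rule cx (rR _ _) (d ∷ []) = rule-R cx d
  rule cx (rL _ _ _) (d ∷ []) = rule-L cx d
  rule cx (rD _ _ _ _) (d ∷ e ∷ []) = rule-D cx d e
  rule cx (rN _ _) (d ∷ []) = rule-N cx d
  rule cx (rFa _ _ _) (d ∷ []) = rule-Fa cx d
  rule cx (rFu _ _ _ _) (d ∷ e ∷ []) = rule-Fu cx d e

module AxiomsFromRules (C : Ext → Set) (𝒮 : Sequent → Set) where
  open STL-Derivations (ExtRules C) 𝒮

  rule₁ : ∀ {x p c} → C x → ExtRule x [ p ] c → ⊢ p → ⊢ c
  rule₁ cx r d = by (inj₂ (inj₂ (_ , cx , r))) (d ∷ [])

  rule₂ : ∀ {x p q c} → C x → ExtRule x (p ∷ q ∷ []) c → ⊢ p → ⊢ q → ⊢ c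
  rule₂ cx r d e = by (inj₂ (inj₂ (_ , cx , r))) (d ∷ e ∷ [])

  axiom : ∀ {x c} → C x → ExtAx x c → ⊢ c
  axiom cD (Da₁ A B C') = ∧-left (swap-head (rule₂ cD (rD [ A ] _ B C')
    (stl₁ (∨R₁ _ _ _) (swap-head (∧-pair A B)))
    (stl₁ (∨R₂ _ _ _) (swap-head (∧-pair A C')))))
  axiom _ (Da₂ A B C') = stl₂ (∨L _ _ _)
    (∧-right (∧-elimˡ A B) (∧-elimʳ A B ⨾ stl₁ (∨R₁ _ _ _) (identity B)))
    (∧-right (∧-elimˡ A C') (∧-elimʳ A C' ⨾ stl₁ (∨R₂ _ _ _) (identity C')))
  axiom _ (Na₁ A B) = ∧-right (∇-mono (∧-elimˡ A B)) (∇-mono (∧-elimʳ A B))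
  axiom cN (Na₂ A B) = ∧-left (rule₁ cN (rN (A ∷ [ B ]) (just (A ∧' B))) (∧-pair A B))
  axiom _ Na₃ = weaken-left (∇ ⊤') ⊤-right
  axiom cN Na₄ = weaken-left ⊤' (rule₁ cN (rN [] (just ⊤')) ⊤-right)
  axiom cR (Ra A) = rule₁ cR (rR [ A ] A) (identity A)
  axiom cL (La A) = rule₁ cL (rL [] (just A) A) (identity A)
  axiom cFa (Faa₁ A) = rule₁ cFa (rFa [ A ] ⊤' A) (weaken-left ⊤' (identity A))
  axiom _ (Faa₂ A) = ∇⊤⟶-elim (identity A)
  axiom _ (Fua₁ A) = ⊤⟶-intro (identity (∇ A))
  axiom cFu (Fua₂ A) = rule₂ cFu (rFu [] (just A) ⊤' (∇ A)) ⊤-right (identity (∇ A))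

rules-derivableIn-axioms : ∀ C → STL[ C ] DerivableIn STLa[ C ]
rules-derivableIn-axioms C =
  STL+-derivableIn {ExtRules C} {ExtAxioms C}
    λ { (_ , cx , r) → RulesFromAxioms.rule C _ cx r }

axioms-derivableIn-rules : ∀ C → STLa[ C ] DerivableIn STL[ C ]
axioms-derivableIn-rules C =
  STL+-derivableIn {ExtAxioms C} {ExtRules C}
    λ { (refl , _ , cx , a) [] → AxiomsFromRules.axiom C _ cx a }

lemma6p3 : (C : Ext → Set) (𝒮 : Sequent → Set) (s : Sequent) →
           ((𝒮 ⊢[ STL[ C ] ] s → 𝒮 ⊢[ STLa[ C ] ] s) ×
            (𝒮 ⊢[ STLa[ C ] ] s → 𝒮 ⊢[ STL[ C ] ] s))
lemma6p3 C 𝒮 s =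
  simulate (rules-derivableIn-axioms C) , simulate (axioms-derivableIn-rules C)
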